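{- Let $\mathbb{K}$ be a field, $\mathcal{A}$ a well ordered domain of variables, and $\mathcal{G}\subseteq\mathbb{K}[\mathcal{A}]$ a Gröbner basis consisting of nonzero polynomials. Then for every polynomial $f\in\mathbb{K}[\mathcal{A}]$ the following are equivalent: (1) $f$ belongs to the equivariant ideal generated by $\mathcal{G}$; (2) there is a finite sequence of division steps $f\to_{\mathcal{G}}\cdots\to_{\mathcal{G}}\mathbf{0}$ (with $\mathbf{0}$ the zero polynomial); (3) every finite sequence of division steps from $f$ ending in a polynomial $f'$ reduced w.r.t. $\mathcal{G}$ has $f'=\mathbf{0}$.
   Context: A domain of variables $\mathcal{A}=(A,\preceq,\dots)$ is a countable relational structure with a definable well order $\preceq$. Embeddings are maps $A\to A$ preserving and reflecting all relations; $\mathrm{Emb}(\mathcal{A})$ denotes them, acting on $\mathbb{K}[\mathcal{A}]$ (polynomials over $\mathbb{K}$ with variables in $A$) by renaming variables. The equivariant ideal generated by $\mathcal{G}$ is the set of all $\sum_i h_i\cdot\iota_i(g_i)$ with $g_i\in\mathcal{G}$, $h_i\in\mathbb{K}[\mathcal{A}]$, $\iota_i\in\mathrm{Emb}(\mathcal{A})$. Lexicographic order on monomials: for $f\neq f'$, take the $\preceq$-largest variable $a$ whose degrees differ, and $f\prec_{lex}f'$ iff $\deg_a f<\deg_a f'$; $\mathrm{lm}(f)$, $\mathrm{lc}(f)$ are the $\prec_{lex}$-largest monomial of a nonzero $f$ and its coefficient. For monomials, $m\sqsubseteq m'$ iff $\iota(m)$ divides $m'$ for some $\iota\in\mathrm{Emb}(\mathcal{A})$.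 $\mathcal{G}$ is a Gröbner basis if for every nonzero $f$ in the equivariant ideal generated by $\mathcal{G}$ there is $g\in\mathcal{G}$ with $\mathrm{lm}(g)\sqsubseteq\mathrm{lm}(f)$. A division step $f\to_{\mathcal{G}}f'$ holds if $f=r\cdot h\cdot\iota(g)+f'$ for some $r\in\mathbb{K}$, monomial $h$, $\iota\in\mathrm{Emb}(\mathcal{A})$, $g\in\mathcal{G}$, such that $h\cdot\iota(\mathrm{lm}(g))$ appears in $f$ with coefficient $r\cdot\mathrm{lc}(g)$; $f$ is reduced if no division step from $f$ exists. -}

module Defs where

open import Level using (0ℓ)
open import Algebra.Bundles using (CommutativeRing)
open import Data.Nat as ℕ using (ℕ; _<_)
open import Data.Fin using (Fin)
open import Data.Bool using (Bool; true; false; _∧_)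
open import Data.List using (List; []; _∷_; _++_; map; concatMap; filter; length)
open import Data.List.Relation.Unary.All using (All)
open import Data.Product using (Σ; ∃; ∃-syntax; _×_; _,_; proj₁; proj₂)
open import Data.Sum using (_⊎_)
open import Function using (_∘_)
open import Function.Bundles using (_⇔_)
open import Function.Definitions using (Injective)
open import Relation.Binary.PropositionalEquality using (_≡_; _≢_)
open import Relation.Binary.Structures using (IsTotalOrder)
open import Induction.WellFounded using (WellFounded)
open import Relation.Binary.Construct.Closure.ReflexiveTransitive using (Star)
open import Relation.Nullary using (¬_; does)

record Field : Set₁ where
  field
    commutativeRing : CommutativeRing 0ℓ 0ℓ
  open CommutativeRing commutativeRing public
  field
    0≉1     : ¬ (0# ≈ 1#)
    inverse : ∀ x → ¬ (x ≈ 0#) → ∃[ y ] (x * y ≈ 1#)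

-- Domains of variables: countable relational structures (arbitrary
-- signature: relation symbols i of arity (arity i)) equipped with a
-- well order _⪯_ which is one of the relations of the structure
-- (so it is (quantifier-free) definable and respected by embeddings).

record Domain : Set₁ where
  field
    A        : Set
    enc      : A → ℕ
    enc-inj  : Injective _≡_ _≡_ enc
    RelSym   : Set
    arity    : RelSym → ℕ
    rel      : (i : RelSym) → (Fin (arity i) → A) → Set
    _⪯_      : A → A → Set
    isTotalOrder : IsTotalOrder _≡_ _⪯_

  _≺_ : A → A → Set
  a ≺ b = (a ⪯ b) × (a ≢ b)

  field
    wellFounded : WellFounded _≺_

module _ (K : Field) (D : Domain) where
  open Field K
  open Domain D

  -- Embeddings: maps A → A preserving and reflecting all relations
  -- (including the order; injectivity then follows from antisymmetry).
  record Emb : Set where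
    field
      fun     : A → A
      pres-⪯  : ∀ a b → (a ⪯ b) ⇔ (fun a ⪯ fun b)
      pres-rel : ∀ i (v : Fin (arity i) → A) → rel i v ⇔ rel i (fun ∘ v)

  -- Monomials: finite multisets of variables, represented by lists
  -- (a list stands for the product of its entries).
  Mon : Set
  Mon = List A

  deg : Mon → A → ℕ
  deg m a = length (filter (λ b → enc a ℕ.≟ enc b) m)

  _≈ₘ_ : Mon → Mon → Set
  m ≈ₘ m' = ∀ a → deg m a ≡ deg m' a

  -- boolean test for _≈ₘ_ (degrees can only differ at variables
  -- occurring in m or m')
  eqMonᵇ : Mon → Mon → Bool
  eqMonᵇ m m' = go (m ++ m')
    where
    go : List A → Bool
    go []       = true
    go (a ∷ as) = does (deg m a ℕ.≟ deg m' a) ∧ go as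

  renMon : Emb → Mon → Mon
  renMon ι m = map (Emb.fun ι) m

  _⊑_ : Mon → Mon → Set
  m ⊑ m' = ∃[ ι ] ∃[ h ] ((renMon ι m ++ h) ≈ₘ m')

  _≺lex_ : Mon → Mon → Set
  m ≺lex m' = ∃[ a ] ((deg m a < deg m' a) × (∀ b → a ≺ b → deg m b ≡ deg m' b))

  -- Polynomials: finite formal sums of terms c·m, represented by lists
  -- of (coefficient, monomial) pairs; equal monomials are added up.
  Poly : Set
  Poly = List (Carrier × Mon)

  coeff : Poly → Mon → Carrier
  coeff [] m = 0#
  coeff ((c , m') ∷ f) m with eqMonᵇ m m'
  ... | true  = c + coeff f m
  ... | false = coeff f m

  _≈ₚ_ : Poly → Poly → Set
  f ≈ₚ g = ∀ m → coeff f m ≈ coeff g m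

  IsZero : Poly → Set
  IsZero f = ∀ m → coeff f m ≈ 0#

  _+ₚ_ : Poly → Poly → Poly
  f +ₚ g = f ++ g

  _*ₚ_ : Poly → Poly → Poly
  f *ₚ g = concatMap (λ t → map (λ s → (proj₁ t * proj₁ s , proj₂ t ++ proj₂ s)) g) f

  term : Carrier → Mon → Poly
  term r h = (r , h) ∷ []

  renPoly : Emb → Poly → Poly
  renPoly ι f = map (λ t → (proj₁ t , renMon ι (proj₂ t))) f

  IsLM : Poly → Mon → Set
  IsLM f m = ¬ (coeff f m ≈ 0#) × (∀ m' → ¬ (coeff f m' ≈ 0#) → (m' ≺lex m) ⊎ (m' ≈ₘ m))

  module _ (G : Poly → Set) where

    combination : List (Poly × Emb × Poly) → Poly
    combination [] = []
    combination ((h , ι , g) ∷ xs) = (h *ₚ renPoly ι g) +ₚ combination xs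

    InIdeal : Poly → Set
    InIdeal f = ∃[ xs ] (All (λ x → G (proj₂ (proj₂ x))) xs × (f ≈ₚ combination xs))

    IsGroebner : Set
    IsGroebner = ∀ f → InIdeal f → ¬ IsZero f → ∀ m → IsLM f m →
                 ∃[ g ] (G g × ∃[ mg ] (IsLM g mg × (mg ⊑ m)))

    Step : Poly → Poly → Set
    Step f f' = ∃[ r ] ∃[ h ] ∃[ ι ] ∃[ g ] (G g × ∃[ mg ] (IsLM g mg
                 × ¬ (coeff f (h ++ renMon ι mg) ≈ 0#)
                 × (coeff f (h ++ renMon ι mg) ≈ r * coeff g mg)
                 × (f ≈ₚ ((term r h *ₚ renPoly ι g) +ₚ f'))))

    Reduced : Poly → Set
    Reduced f = ¬ (∃[ f' ] Step f f')

    _→*_ : Poly → Poly → Set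
    _→*_ = Star Step

{-# OPTIONS --safe #-}
module Submission where

-- Division steps change a polynomial by a multiple r·h·ι(g) of a generator,
-- so they preserve and reflect membership in the equivariant ideal.  Hence
-- (2) ⇒ (1), and (1) ⇒ (3) because a nonzero reduced element of the ideal
-- would, by the Gröbner property, admit a division step at its leading
-- monomial.  What remains is that every f reduces to a reduced polynomial:
-- a step eliminating the largest reducible monomial M leaves the monomials
-- above M untouched, so the largest reducible monomial strictly decreases,
-- and the lexicographic order on monomials over a well-ordered set of
-- variables is well founded.

open import Defs
open import Level using (0ℓ)
open import Axiom.ExcludedMiddle using (ExcludedMiddle)
open import Data.Bool using (Bool; true; false; T; _∧_)
open import Data.Bool.ListAction using (all)
open import Data.List using (List; []; _∷_; _++_; map; filter; length)
open import Data.List.Properties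
  using (filter-accept; filter-reject; filter-++; filter-some; filter-none; length-++; map-++)
import Data.List.Extrema as Extrema
open import Data.List.Membership.Propositional using (_∈_; _∉_)
open import Data.List.Membership.Propositional.Properties using (∈-++⁺ˡ; ∈-++⁺ʳ; ∈-map⁻)
open import Data.List.Relation.Unary.All as All using (All; []; _∷_)
open import Data.List.Relation.Unary.All.Properties using (¬Any⇒All¬; all⁺; all⁻)
open import Data.List.Relation.Unary.Any as Any using (Any; here; there)
open import Data.Nat using (ℕ; suc; _<_; _≡ᵇ_; z≤n)
open import Data.Nat.Induction using (<-wellFounded)
import Data.Nat.Properties as ℕ
open import Data.Product using (_×_; ∃-syntax; _,_; proj₁; proj₂)
open import Data.Product.Relation.Binary.Lex.Strict using (×-Lex; ×-wellFounded)
open import Data.Sum as Sum using (_⊎_; inj₁; inj₂; [_,_]′)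
open import Data.Unit using (⊤; tt)
open import Function using (_∘_; id; _on_)
open import Function.Bundles using (Equivalence; _⇔_; mk⇔)
open import Function.Definitions using (Injective)
open import Induction.WellFounded using (Acc; acc; WellFounded; module Subrelation)
open import Relation.Binary
  using ( Rel; Total; Transitive; Irreflexive; Asymmetric; _Respectsʳ_; _Respectsˡ_
        ; Trichotomous; tri<; tri≈; tri>; DecidableEquality)
open import Relation.Binary.Bundles using (TotalOrder)
open import Relation.Binary.Structures using (IsEquivalence; IsStrictTotalOrder; IsTotalOrder)
open import Relation.Binary.Construct.Closure.ReflexiveTransitive using (ε; _◅_)
import Relation.Binary.Construct.On as On
import Relation.Binary.Construct.StrictToNonStrict as StrictToNonStrict
open import Relation.Binary.PropositionalEquality
  using (_≡_; _≢_; refl; sym; trans; cong; subst; subst₂; module ≡-Reasoning)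
open import Relation.Nullary using (¬_; yes; no)
open import Relation.Nullary.Decidable using (map′; ¬?; decidable-stable; toSum)
open import Relation.Nullary.Negation using (contradiction)
open import Relation.Unary using (Pred; Decidable)

module _ {X : Set} {_≤_ : Rel X 0ℓ} (total : Total _≤_) (≤-trans : Transitive _≤_)
         {P : Pred X 0ℓ} (P? : Decidable P) where

  private
    ≤-refl : ∀ {x} → x ≤ x
    ≤-refl {x} = [ id , id ]′ (total x x)

  maximum-satisfying : ∀ {xs} → Any P xs → ∃[ b ] (P b × b ∈ xs × All (λ x → P x → x ≤ b) xs)
  maximum-satisfying {x ∷ xs} p with P? x
  ... | no ¬px with maximum-satisfying (Any.tail ¬px p)
  ...   | b , pb , b∈xs , maximal = b , pb , there b∈xs , (λ px → contradiction px ¬px) ∷ maximal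
  maximum-satisfying {x ∷ xs} p | yes px with Any.any? P? xs
  ...   | no ¬q =
    x , px , here refl , (λ _ → ≤-refl) ∷ All.map (λ ¬py py → contradiction py ¬py) (¬Any⇒All¬ xs ¬q)
  ...   | yes q with maximum-satisfying q
  ...     | b , pb , b∈xs , maximal with total x b
  ...       | inj₁ x≤b = b , pb , there b∈xs , (λ _ → x≤b) ∷ maximal
  ...       | inj₂ b≤x =
    x , px , here refl , (λ _ → ≤-refl) ∷ All.map (λ y≤b py → ≤-trans (y≤b py) b≤x) maximal

module Monomials (K : Field) (D : Domain) where
  open Domain D
  open import Data.Nat using (_+_)
  open IsTotalOrder isTotalOrder using (total; antisym)
    renaming (refl to ⪯-refl; reflexive to ⪯-reflexive; trans to ⪯-trans)

  _≟ᵥ_ : DecidableEquality A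
  a ≟ᵥ b = map′ enc-inj (cong enc) (enc a ℕ.≟ enc b)

  open import Data.List.Membership.DecPropositional _≟ᵥ_ using (_∈?_)

  deg-∷-self : ∀ x m → deg K D (x ∷ m) x ≡ suc (deg K D m x)
  deg-∷-self x m = cong length (filter-accept (λ b → enc x ℕ.≟ enc b) refl)

  deg-∷-≢ : ∀ {a x} m → a ≢ x → deg K D (x ∷ m) a ≡ deg K D m a
  deg-∷-≢ {a} m a≢x = cong length (filter-reject (λ b → enc a ℕ.≟ enc b) (a≢x ∘ enc-inj))

  deg-++ : ∀ m m' a → deg K D (m ++ m') a ≡ deg K D m a + deg K D m' a
  deg-++ m m' a =
    trans (cong length (filter-++ (λ b → enc a ℕ.≟ enc b) m m')) (length-++ (filter (λ b → enc a ℕ.≟ enc b) m))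

  ∈⇒deg>0 : ∀ {a m} → a ∈ m → 0 < deg K D m a
  ∈⇒deg>0 {a} a∈m = filter-some (λ b → enc a ℕ.≟ enc b) (Any.map (cong enc) a∈m)

  deg-∉ : ∀ m {a} → a ∉ m → deg K D m a ≡ 0
  deg-∉ m {a} a∉m =
    cong length (filter-none (λ b → enc a ℕ.≟ enc b) (All.map (_∘ enc-inj) (¬Any⇒All¬ m a∉m)))

  deg>0⇒∈ : ∀ {a m} → 0 < deg K D m a → a ∈ m
  deg>0⇒∈ {a} {m} pos = decidable-stable (a ∈? m) (ℕ.>⇒≢ pos ∘ deg-∉ m)

  ∉⇒deg≡ : ∀ m m' {a} → a ∉ m ++ m' → deg K D m a ≡ deg K D m' a
  ∉⇒deg≡ m m' a∉ = trans (deg-∉ m (a∉ ∘ ∈-++⁺ˡ)) (sym (deg-∉ m' (a∉ ∘ ∈-++⁺ʳ m)))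

  -- Record wrappers: unfolded, _≈ₘ_ and _≺lex_ are Π/Σ types from which
  -- Agda cannot infer the monomials being compared.
  infix 4 _≃_ _<ₗ_

  record _≃_ (m m' : Mon K D) : Set where
    constructor mk≃
    field deg≡ : _≈ₘ_ K D m m'
  open _≃_ public

  record _<ₗ_ (m m' : Mon K D) : Set where
    constructor mk<ₗ
    field lex : _≺lex_ K D m m'
  open _<ₗ_ public

  ≃-isEquivalence : IsEquivalence _≃_
  ≃-isEquivalence = record
    { refl  = mk≃ λ _ → refl
    ; sym   = λ e → mk≃ λ a → sym (deg≡ e a)
    ; trans = λ e e' → mk≃ λ a → trans (deg≡ e a) (deg≡ e' a)
    }

  open IsEquivalence ≃-isEquivalence public
    using () renaming (refl to ≃-refl; sym to ≃-sym; trans to ≃-trans)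

  ≃-from-vars : ∀ {m m'} → (∀ a → a ∈ m ++ m' → deg K D m a ≡ deg K D m' a) → m ≃ m'
  ≃-from-vars {m} {m'} agree = mk≃ λ a → [ agree a , ∉⇒deg≡ m m' ]′ (toSum (a ∈? (m ++ m')))

  -- The auxiliary function go of eqMonᵇ cannot be named: it is identified
  -- with all through its defining equations, before its argument m ++ m'
  -- is abstracted.
  private
    all-by-equations : ∀ (p : A → Bool) (go : List A → Bool) → go [] ≡ true →
                       (∀ a as → go (a ∷ as) ≡ (p a ∧ go as)) → ∀ as → go as ≡ all p as
    all-by-equations p go go[] go∷ [] = go[]
    all-by-equations p go go[] go∷ (a ∷ as) =
      trans (go∷ a as) (cong (p a ∧_) (all-by-equations p go go[] go∷ as))

  eqMonᵇ≡all : ∀ m m' → eqMonᵇ K D m m' ≡ all (λ a → deg K D m a ≡ᵇ deg K D m' a) (m ++ m')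
  eqMonᵇ≡all m m'
    with all-by-equations (λ a → deg K D m a ≡ᵇ deg K D m' a) _ refl (λ _ _ → refl) | m ++ m'
  ... | go≡all | as = go≡all as

  eqMonᵇ-sound : ∀ {m m'} → T (eqMonᵇ K D m m') → m ≃ m'
  eqMonᵇ-sound {m} {m'} t = ≃-from-vars λ a a∈ →
    ℕ.≡ᵇ⇒≡ _ _ (All.lookup (all⁺ _ (m ++ m') (subst T (eqMonᵇ≡all m m') t)) a∈)

  eqMonᵇ-complete : ∀ {m m'} → m ≃ m' → T (eqMonᵇ K D m m')
  eqMonᵇ-complete {m} {m'} e =
    subst T (sym (eqMonᵇ≡all m m')) (all⁻ _ {m ++ m'} (All.tabulate λ {a} _ → ℕ.≡⇒≡ᵇ _ _ (deg≡ e a)))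

  ⪯-≺-trans : ∀ {a b c} → a ⪯ b → b ≺ c → a ≺ c
  ⪯-≺-trans a⪯b (b⪯c , b≢c) = ⪯-trans a⪯b b⪯c , λ { refl → b≢c (antisym b⪯c a⪯b) }

  differs⇒∈ : ∀ m m' {a} → deg K D m a ≢ deg K D m' a → a ∈ m ++ m'
  differs⇒∈ m m' {a} differs = decidable-stable (a ∈? (m ++ m')) (differs ∘ ∉⇒deg≡ m m')

  <ₗ-irrefl : Irreflexive _≃_ _<ₗ_
  <ₗ-irrefl e (mk<ₗ (a , lt , _)) = ℕ.<-irrefl (deg≡ e a) lt

  <ₗ-trans : Transitive _<ₗ_
  <ₗ-trans {m₁} {m₂} {m₃} (mk<ₗ (a , lt₁ , above₁)) (mk<ₗ (b , lt₂ , above₂)) with a ≟ᵥ b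
  ... | yes refl = mk<ₗ (a , ℕ.<-trans lt₁ lt₂ , λ c a≺c → trans (above₁ c a≺c) (above₂ c a≺c))
  ... | no a≢b with total a b
  ...   | inj₁ a⪯b = mk<ₗ (b , subst (_< deg K D m₃ b) (sym (above₁ b (a⪯b , a≢b))) lt₂ ,
                            λ c b≺c → trans (above₁ c (⪯-≺-trans a⪯b b≺c)) (above₂ c b≺c))
  ...   | inj₂ b⪯a = mk<ₗ (a , subst (deg K D m₁ a <_) (above₂ a (b⪯a , a≢b ∘ sym)) lt₁ ,
                            λ c a≺c → trans (above₁ c a≺c) (above₂ c (⪯-≺-trans b⪯a a≺c)))

  <ₗ-asym : Asymmetric _<ₗ_
  <ₗ-asym lt lt' = <ₗ-irrefl ≃-refl (<ₗ-trans lt lt')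

  <ₗ-respʳ-≃ : _<ₗ_ Respectsʳ _≃_
  <ₗ-respʳ-≃ {m} e (mk<ₗ (a , lt , above)) =
    mk<ₗ (a , subst (deg K D m a <_) (deg≡ e a) lt , λ b a≺b → trans (above b a≺b) (deg≡ e b))

  <ₗ-respˡ-≃ : _<ₗ_ Respectsˡ _≃_
  <ₗ-respˡ-≃ {m} e (mk<ₗ (a , lt , above)) =
    mk<ₗ (a , subst (_< deg K D m a) (deg≡ e a) lt , λ b a≺b → trans (sym (deg≡ e b)) (above b a≺b))

  agree-above-differences : ∀ m m' {b} → All (λ a → deg K D m a ≢ deg K D m' a → a ⪯ b) (m ++ m') →
                            ∀ {c} → b ≺ c → deg K D m c ≡ deg K D m' c
  agree-above-differences m m' maximal {c} (b⪯c , b≢c) with deg K D m c ℕ.≟ deg K D m' c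
  ... | yes agree = agree
  ... | no differs = contradiction (antisym b⪯c (All.lookup maximal (differs⇒∈ m m' differs) differs)) b≢c

  <ₗ-compare : Trichotomous _≃_ _<ₗ_
  <ₗ-compare m m' with Any.any? (λ a → ¬? (deg K D m a ℕ.≟ deg K D m' a)) (m ++ m')
  ... | no none = tri≈ (<ₗ-irrefl e) e (<ₗ-irrefl (≃-sym e))
    where
    e : m ≃ m'
    e = ≃-from-vars λ a a∈ → decidable-stable (_ ℕ.≟ _) (All.lookup (¬Any⇒All¬ _ none) a∈)
  ... | yes some with maximum-satisfying total ⪯-trans (λ a → ¬? (deg K D m a ℕ.≟ deg K D m' a)) some
  ...   | b , b-differs , _ , maximal with ℕ.<-cmp (deg K D m b) (deg K D m' b)
  ...     | tri< lt _ _ = tri< m<m' (λ e → <ₗ-irrefl e m<m') (<ₗ-asym m<m')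
    where
    m<m' : m <ₗ m'
    m<m' = mk<ₗ (b , lt , λ c → agree-above-differences m m' maximal)
  ...     | tri≈ _ eq _ = contradiction eq b-differs
  ...     | tri> _ _ gt = tri> (<ₗ-asym m'<m) (λ e → <ₗ-irrefl (≃-sym e) m'<m) m'<m
    where
    m'<m : m' <ₗ m
    m'<m = mk<ₗ (b , gt , λ c → sym ∘ agree-above-differences m m' maximal)

  <ₗ-isStrictTotalOrder : IsStrictTotalOrder _≃_ _<ₗ_
  <ₗ-isStrictTotalOrder = record
    { isStrictPartialOrder = record
      { isEquivalence = ≃-isEquivalence
      ; irrefl        = <ₗ-irrefl
      ; trans         = <ₗ-trans
      ; <-resp-≈      = <ₗ-respʳ-≃ , <ₗ-respˡ-≃
      }
    ; compare = <ₗ-compare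
    }

  open IsStrictTotalOrder <ₗ-isStrictTotalOrder public using () renaming (_≟_ to _≃?_)

  open StrictToNonStrict _≃_ _<ₗ_ public using () renaming (_≤_ to _≤ₗ_)

  ≤ₗ-isTotalOrder : IsTotalOrder _≃_ _≤ₗ_
  ≤ₗ-isTotalOrder = StrictToNonStrict.isTotalOrder _≃_ _<ₗ_ <ₗ-isStrictTotalOrder

  open IsTotalOrder ≤ₗ-isTotalOrder public using ()
    renaming (total to ≤ₗ-total; trans to ≤ₗ-trans; ≲-respˡ-≈ to ≤ₗ-respˡ-≃)

  <ₗ⇒≱ₗ : ∀ {m m'} → m <ₗ m' → ¬ m' ≤ₗ m
  <ₗ⇒≱ₗ lt (inj₁ lt') = <ₗ-asym lt lt'
  <ₗ⇒≱ₗ lt (inj₂ e) = <ₗ-irrefl (≃-sym e) lt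

  deg-++ˡ-cong : ∀ h m m' a → deg K D m a ≡ deg K D m' a → deg K D (h ++ m) a ≡ deg K D (h ++ m') a
  deg-++ˡ-cong h m m' a eq = begin
    deg K D (h ++ m) a          ≡⟨ deg-++ h m a ⟩
    deg K D h a + deg K D m a   ≡⟨ cong (deg K D h a +_) eq ⟩
    deg K D h a + deg K D m' a  ≡⟨ deg-++ h m' a ⟨
    deg K D (h ++ m') a         ∎
    where open ≡-Reasoning

  ≃-++ˡ : ∀ h {m m'} → m ≃ m' → h ++ m ≃ h ++ m'
  ≃-++ˡ h {m} {m'} e = mk≃ λ a → deg-++ˡ-cong h m m' a (deg≡ e a)

  ++-comm-≃ : ∀ m m' → m ++ m' ≃ m' ++ m
  ++-comm-≃ m m' = mk≃ λ a → begin
    deg K D (m ++ m') a         ≡⟨ deg-++ m m' a ⟩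
    deg K D m a + deg K D m' a  ≡⟨ ℕ.+-comm (deg K D m a) _ ⟩
    deg K D m' a + deg K D m a  ≡⟨ deg-++ m' m a ⟨
    deg K D (m' ++ m) a         ∎
    where open ≡-Reasoning

  <ₗ-++ˡ : ∀ h {m m'} → m <ₗ m' → h ++ m <ₗ h ++ m'
  <ₗ-++ˡ h {m} {m'} (mk<ₗ (a , lt , above)) = mk<ₗ (a , lt-h , above-h)
    where
    lt-h : deg K D (h ++ m) a < deg K D (h ++ m') a
    lt-h = subst₂ _<_ (sym (deg-++ h m a)) (sym (deg-++ h m' a)) (ℕ.+-monoʳ-< (deg K D h a) lt)
    above-h : ∀ b → a ≺ b → deg K D (h ++ m) b ≡ deg K D (h ++ m') b
    above-h b a≺b = deg-++ˡ-cong h m m' b (above b a≺b)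

  module _ (ι : Emb K D) where
    open Emb ι using (fun; pres-⪯)

    emb-injective : Injective _≡_ _≡_ fun
    emb-injective {a} {b} eq =
      antisym (Equivalence.from (pres-⪯ a b) (⪯-reflexive eq))
              (Equivalence.from (pres-⪯ b a) (⪯-reflexive (sym eq)))

    emb-reflects-≺ : ∀ {a b} → fun a ≺ fun b → a ≺ b
    emb-reflects-≺ {a} {b} (fa⪯fb , fa≢fb) = Equivalence.from (pres-⪯ a b) fa⪯fb , fa≢fb ∘ cong fun

    deg-renMon : ∀ m a → deg K D (renMon K D ι m) (fun a) ≡ deg K D m a
    deg-renMon [] a = refl
    deg-renMon (x ∷ m) a with a ≟ᵥ x
    ... | yes refl =
      trans (deg-∷-self (fun a) (renMon K D ι m)) (trans (cong suc (deg-renMon m a)) (sym (deg-∷-self a m)))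
    ... | no a≢x =
      trans (deg-∷-≢ (renMon K D ι m) (a≢x ∘ emb-injective)) (trans (deg-renMon m a) (sym (deg-∷-≢ m a≢x)))

    deg-renMon-cong : ∀ m m' b → (∀ c → b ≡ fun c → deg K D m c ≡ deg K D m' c) →
                      deg K D (renMon K D ι m) b ≡ deg K D (renMon K D ι m') b
    deg-renMon-cong m m' b agree with b ∈? (renMon K D ι m ++ renMon K D ι m')
    ... | no b∉ = ∉⇒deg≡ (renMon K D ι m) (renMon K D ι m') b∉
    ... | yes b∈ with ∈-map⁻ fun (subst (b ∈_) (sym (map-++ fun m m')) b∈)
    ...   | c , _ , refl = trans (deg-renMon m c) (trans (agree c refl) (sym (deg-renMon m' c)))

    ≃-renMon : ∀ {m m'} → m ≃ m' → renMon K D ι m ≃ renMon K D ι m'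
    ≃-renMon {m} {m'} e = mk≃ λ b → deg-renMon-cong m m' b (λ c _ → deg≡ e c)

    <ₗ-renMon : ∀ {m m'} → m <ₗ m' → renMon K D ι m <ₗ renMon K D ι m'
    <ₗ-renMon {m} {m'} (mk<ₗ (a , lt , above)) = mk<ₗ (fun a , lt-ι , above-ι)
      where
      lt-ι : deg K D (renMon K D ι m) (fun a) < deg K D (renMon K D ι m') (fun a)
      lt-ι = subst₂ _<_ (sym (deg-renMon m a)) (sym (deg-renMon m' a)) lt
      above-ι : ∀ b → fun a ≺ b → deg K D (renMon K D ι m) b ≡ deg K D (renMon K D ι m') b
      above-ι b fa≺b = deg-renMon-cong m m' b λ { c refl → above c (emb-reflects-≺ fa≺b) }

  shift : Mon K D → Emb K D → Mon K D → Mon K D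
  shift h ι m = h ++ renMon K D ι m

  module _ (h : Mon K D) (ι : Emb K D) where
    open Emb ι using (fun)

    shift-cong : ∀ {m m'} → m ≃ m' → shift h ι m ≃ shift h ι m'
    shift-cong = ≃-++ˡ h ∘ ≃-renMon ι

    shift-mono-<ₗ : ∀ {m m'} → m <ₗ m' → shift h ι m <ₗ shift h ι m'
    shift-mono-<ₗ = <ₗ-++ˡ h ∘ <ₗ-renMon ι

    shift-mono-≤ₗ : ∀ {m m'} → m ≤ₗ m' → shift h ι m ≤ₗ shift h ι m'
    shift-mono-≤ₗ = Sum.map shift-mono-<ₗ shift-cong

    deg-shift-image : ∀ m a → deg K D (shift h ι m) (fun a) ≡ deg K D h (fun a) + deg K D m a
    deg-shift-image m a = trans (deg-++ h (renMon K D ι m) (fun a)) (cong (deg K D h (fun a) +_) (deg-renMon ι m a))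

    shift-injective : ∀ {m m'} → shift h ι m ≃ shift h ι m' → m ≃ m'
    shift-injective {m} {m'} e = mk≃ λ a → ℕ.+-cancelˡ-≡ (deg K D h (fun a)) _ _
      (trans (sym (deg-shift-image m a)) (trans (deg≡ e (fun a)) (deg-shift-image m' a)))

  Bounded : A → Mon K D → Set
  Bounded a = All (_⪯ a)

  remove : A → Mon K D → Mon K D
  remove a [] = []
  remove a (x ∷ m) with a ≟ᵥ x
  ... | yes _ = remove a m
  ... | no _ = x ∷ remove a m

  deg-remove-self : ∀ a m → deg K D (remove a m) a ≡ 0
  deg-remove-self a [] = refl
  deg-remove-self a (x ∷ m) with a ≟ᵥ x
  ... | yes _ = deg-remove-self a m
  ... | no a≢x = trans (deg-∷-≢ (remove a m) a≢x) (deg-remove-self a m)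

  deg-remove-other : ∀ a m {b} → b ≢ a → deg K D (remove a m) b ≡ deg K D m b
  deg-remove-other a [] b≢a = refl
  deg-remove-other a (x ∷ m) {b} b≢a with a ≟ᵥ x | b ≟ᵥ x
  ... | yes refl | _ = trans (deg-remove-other a m b≢a) (sym (deg-∷-≢ m b≢a))
  ... | no _ | yes refl =
    trans (deg-∷-self b (remove a m)) (trans (cong suc (deg-remove-other a m b≢a)) (sym (deg-∷-self b m)))
  ... | no _ | no b≢x =
    trans (deg-∷-≢ (remove a m) b≢x) (trans (deg-remove-other a m b≢a) (sym (deg-∷-≢ m b≢x)))

  remove-below : ∀ {a} m → Bounded a m → All (_≺ a) (remove a m)
  remove-below [] [] = []
  remove-below {a} (x ∷ m) (x⪯a ∷ m⪯a) with a ≟ᵥ x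
  ... | yes _ = remove-below m m⪯a
  ... | no a≢x = (x⪯a , a≢x ∘ sym) ∷ remove-below m m⪯a

  lex-witness-bounded : ∀ {a m} m' {c} → Bounded a m → deg K D m' c < deg K D m c → c ⪯ a
  lex-witness-bounded m' bm lt = All.lookup bm (deg>0⇒∈ (ℕ.≤-<-trans z≤n lt))

  <ₗ-bounded : ∀ {a m m'} → Bounded a m → m' <ₗ m → Bounded a m'
  <ₗ-bounded {a} {m} {m'} bm (mk<ₗ (c , lt , above)) = All.tabulate bounded
    where
    bounded : ∀ {x} → x ∈ m' → x ⪯ a
    bounded {x} x∈m' with total x a | x ≟ᵥ a
    ... | inj₁ x⪯a | _ = x⪯a
    ... | inj₂ _ | yes refl = ⪯-refl
    ... | inj₂ a⪯x | no x≢a = contradiction (antisym (All.lookup bm x∈m) a⪯x) x≢a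
      where
      x∈m : x ∈ m
      x∈m = deg>0⇒∈ (subst (0 <_) (above x c≺x) (∈⇒deg>0 x∈m'))
        where
        c≺x : c ≺ x
        c≺x = ⪯-≺-trans (lex-witness-bounded m' bm lt) (a⪯x , x≢a ∘ sym)

  <ₗ-bounded-split : ∀ {a m m'} → Bounded a m → m' <ₗ m →
                     deg K D m' a < deg K D m a ⊎ (deg K D m' a ≡ deg K D m a × remove a m' <ₗ remove a m)
  <ₗ-bounded-split {a} {m} {m'} bm (mk<ₗ (c , lt , above)) with c ≟ᵥ a
  ... | yes refl = inj₁ lt
  ... | no c≢a = inj₂ (above a c≺a , mk<ₗ (c , lt-remove , above-remove))
    where
    c≺a : c ≺ a
    c≺a = lex-witness-bounded m' bm lt , c≢a
    lt-remove : deg K D (remove a m') c < deg K D (remove a m) c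
    lt-remove = subst₂ _<_ (sym (deg-remove-other a m' c≢a)) (sym (deg-remove-other a m c≢a)) lt
    above-remove : ∀ b → c ≺ b → deg K D (remove a m') b ≡ deg K D (remove a m) b
    above-remove b c≺b with b ≟ᵥ a
    ... | yes refl = trans (deg-remove-self a m') (sym (deg-remove-self a m))
    ... | no b≢a = trans (deg-remove-other a m' b≢a) (trans (above b c≺b) (sym (deg-remove-other a m b≢a)))

  ⪯-totalOrder : TotalOrder 0ℓ 0ℓ 0ℓ
  ⪯-totalOrder = record { isTotalOrder = isTotalOrder }

  open Extrema ⪯-totalOrder using (max; ⊥≤max; xs≤max; max<v⁺)

  bounded-by-max : ∀ x xs → Bounded (max x xs) (x ∷ xs)
  bounded-by-max x xs = ⊥≤max x xs ∷ xs≤max x xs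

  acc-[] : Acc _<ₗ_ []
  acc-[] = acc λ { (mk<ₗ (_ , lt , _)) → contradiction lt ℕ.n≮0 }

  -- For m bounded by a, m' <ₗ m compares first the degrees in a and then
  -- the parts strictly below a, which are accessible by induction on a.
  acc-bounded : ∀ {a} → Acc _≺_ a → ∀ m → Bounded a m → Acc _<ₗ_ m
  acc-bounded {a} (acc rs) m bm =
    acc-by-lex m bm (On.wellFounded split (×-wellFounded <-wellFounded ⊏-wellFounded) m)
    where
    acc-below : ∀ r → All (_≺ a) r → Acc _<ₗ_ r
    acc-below [] _ = acc-[]
    acc-below (x ∷ xs) (x≺a ∷ xs≺a) = acc-bounded (rs (max<v⁺ x≺a xs≺a)) (x ∷ xs) (bounded-by-max x xs)

    _⊏_ : Rel (Mon K D) 0ℓ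
    r ⊏ r' = All (_≺ a) r × r <ₗ r'

    ⊏-wellFounded : WellFounded _⊏_
    ⊏-wellFounded r = acc λ { {r'} (r'≺a , _) → Subrelation.accessible proj₂ (acc-below r' r'≺a) }

    split : Mon K D → ℕ × Mon K D
    split m = deg K D m a , remove a m

    _◁_ : Rel (Mon K D) 0ℓ
    _◁_ = ×-Lex _≡_ _<_ _⊏_ on split

    acc-by-lex : ∀ m → Bounded a m → Acc _◁_ m → Acc _<ₗ_ m
    acc-by-lex m bm (acc rs◁) = acc λ {m'} m'<m →
      let bm' = <ₗ-bounded bm m'<m
      in acc-by-lex m' bm' (rs◁ (Sum.map₂ (λ (eq , lt) → eq , remove-below m' bm' , lt)
                                          (<ₗ-bounded-split bm m'<m)))

  <ₗ-wellFounded : WellFounded _<ₗ_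
  <ₗ-wellFounded [] = acc-[]
  <ₗ-wellFounded (x ∷ xs) = acc-bounded (wellFounded (max x xs)) (x ∷ xs) (bounded-by-max x xs)

module Polynomials (em : ExcludedMiddle 0ℓ) (K : Field) (D : Domain) where
  open Field K renaming (refl to ≈-refl; sym to ≈-sym; trans to ≈-trans; reflexive to ≈-reflexive)
  open Monomials K D
  open import Algebra.Properties.Ring ring
    using (-‿distribˡ-*; -‿+-comm; -0#≈0#; \\-leftDividesˡ; \\-leftDividesʳ)
  open import Relation.Binary.Reasoning.Setoid setoid

  coeff-∷-≃ : ∀ {c m' m} f → m ≃ m' → coeff K D ((c , m') ∷ f) m ≡ c + coeff K D f m
  coeff-∷-≃ {c} {m'} {m} f e with eqMonᵇ K D m m' | eqMonᵇ-complete e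
  ... | true | _ = refl

  coeff-∷-≄ : ∀ {c m' m} f → ¬ m ≃ m' → coeff K D ((c , m') ∷ f) m ≡ coeff K D f m
  coeff-∷-≄ {c} {m'} {m} f m≄m' with eqMonᵇ K D m m' in eq
  ... | true = contradiction (eqMonᵇ-sound (subst T (sym eq) _)) m≄m'
  ... | false = refl

  coeff-cong : ∀ f {m₁ m₂} → m₁ ≃ m₂ → coeff K D f m₁ ≈ coeff K D f m₂
  coeff-cong [] e = ≈-refl
  coeff-cong ((c , m') ∷ f) {m₁} {m₂} e with m₁ ≃? m'
  ... | yes e₁ = begin
    coeff K D ((c , m') ∷ f) m₁  ≡⟨ coeff-∷-≃ f e₁ ⟩
    c + coeff K D f m₁           ≈⟨ +-congˡ (coeff-cong f e) ⟩
    c + coeff K D f m₂           ≡⟨ coeff-∷-≃ f (≃-trans (≃-sym e) e₁) ⟨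
    coeff K D ((c , m') ∷ f) m₂  ∎
  ... | no m₁≄m' = begin
    coeff K D ((c , m') ∷ f) m₁  ≡⟨ coeff-∷-≄ f m₁≄m' ⟩
    coeff K D f m₁               ≈⟨ coeff-cong f e ⟩
    coeff K D f m₂               ≡⟨ coeff-∷-≄ f (m₁≄m' ∘ ≃-trans e) ⟨
    coeff K D ((c , m') ∷ f) m₂  ∎

  coeff-++ : ∀ f g m → coeff K D (f ++ g) m ≈ coeff K D f m + coeff K D g m
  coeff-++ [] g m = ≈-sym (+-identityˡ _)
  coeff-++ ((c , m') ∷ f) g m with eqMonᵇ K D m m'
  ... | true = ≈-trans (+-congˡ (coeff-++ f g m)) (≈-sym (+-assoc _ _ _))
  ... | false = coeff-++ f g m

  ++-congˡ-≈ₚ : ∀ f {g g'} → _≈ₚ_ K D g g' → _≈ₚ_ K D (f ++ g) (f ++ g')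
  ++-congˡ-≈ₚ f {g} {g'} g≈g' m = begin
    coeff K D (f ++ g) m            ≈⟨ coeff-++ f g m ⟩
    coeff K D f m + coeff K D g m   ≈⟨ +-congˡ (g≈g' m) ⟩
    coeff K D f m + coeff K D g' m  ≈⟨ coeff-++ f g' m ⟨
    coeff K D (f ++ g') m           ∎

  monomials : Poly K D → List (Mon K D)
  monomials = map proj₂

  coeff≉0⇒∈ : ∀ f m → ¬ coeff K D f m ≈ 0# → Any (m ≃_) (monomials f)
  coeff≉0⇒∈ [] m nz = contradiction ≈-refl nz
  coeff≉0⇒∈ ((c , m') ∷ f) m nz with eqMonᵇ K D m m' in eq
  ... | true = here (eqMonᵇ-sound (subst T (sym eq) _))
  ... | false = there (coeff≉0⇒∈ f m nz)

  scaledShift : Carrier → Mon K D → Emb K D → Poly K D → Poly K D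
  scaledShift r h ι g = _*ₚ_ K D (term K D r h) (renPoly K D ι g)

  module _ (r : Carrier) (h : Mon K D) (ι : Emb K D) where

    coeff-scaledShift : ∀ g {m m₀} → m ≃ shift h ι m₀ →
                        coeff K D (scaledShift r h ι g) m ≈ r * coeff K D g m₀
    coeff-scaledShift [] e = ≈-sym (zeroʳ r)
    coeff-scaledShift ((c , m') ∷ g) {m} {m₀} e with m₀ ≃? m'
    ... | yes e' = begin
      coeff K D (scaledShift r h ι ((c , m') ∷ g)) m  ≡⟨ coeff-∷-≃ (scaledShift r h ι g) m≃ ⟩
      r * c + coeff K D (scaledShift r h ι g) m       ≈⟨ +-congˡ (coeff-scaledShift g e) ⟩
      r * c + r * coeff K D g m₀                      ≈⟨ distribˡ r c _ ⟨
      r * (c + coeff K D g m₀)                        ≡⟨ cong (r *_) (coeff-∷-≃ g e') ⟨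
      r * coeff K D ((c , m') ∷ g) m₀                 ∎
      where
      m≃ : m ≃ shift h ι m'
      m≃ = ≃-trans e (shift-cong h ι e')
    ... | no m₀≄m' = begin
      coeff K D (scaledShift r h ι ((c , m') ∷ g)) m  ≡⟨ coeff-∷-≄ (scaledShift r h ι g) m≄ ⟩
      coeff K D (scaledShift r h ι g) m               ≈⟨ coeff-scaledShift g e ⟩
      r * coeff K D g m₀                              ≡⟨ cong (r *_) (coeff-∷-≄ g m₀≄m') ⟨
      r * coeff K D ((c , m') ∷ g) m₀                 ∎
      where
      m≄ : ¬ m ≃ shift h ι m'
      m≄ = m₀≄m' ∘ shift-injective h ι ∘ ≃-trans (≃-sym e)

    coeff-scaledShift-outside : ∀ g {m} → (∀ m₀ → ¬ m ≃ shift h ι m₀) →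
                                coeff K D (scaledShift r h ι g) m ≈ 0#
    coeff-scaledShift-outside [] _ = ≈-refl
    coeff-scaledShift-outside ((c , m') ∷ g) outside =
      ≈-trans (≈-reflexive (coeff-∷-≄ (scaledShift r h ι g) (outside m')))
              (coeff-scaledShift-outside g outside)

    coeff-scaledShift-neg : ∀ g m → coeff K D (scaledShift (- r) h ι g) m ≈ - coeff K D (scaledShift r h ι g) m
    coeff-scaledShift-neg [] m = ≈-sym -0#≈0#
    coeff-scaledShift-neg ((c , m') ∷ g) m with eqMonᵇ K D m (shift h ι m')
    ... | true = ≈-trans (+-cong (≈-sym (-‿distribˡ-* r c)) (coeff-scaledShift-neg g m)) (-‿+-comm _ _)
    ... | false = coeff-scaledShift-neg g m

    scaledShift-support : ∀ g {m} → ¬ coeff K D (scaledShift r h ι g) m ≈ 0# →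
                          ∃[ m₀ ] (m ≃ shift h ι m₀ × ¬ coeff K D g m₀ ≈ 0#)
    scaledShift-support g {m} nz with em {∃[ m₀ ] m ≃ shift h ι m₀}
    ... | yes (m₀ , e) =
      m₀ , e , λ z → nz (≈-trans (coeff-scaledShift g e) (≈-trans (*-congˡ z) (zeroʳ r)))
    ... | no none = contradiction (coeff-scaledShift-outside g λ m₀ e → none (m₀ , e)) nz

    scaledShift-split : ∀ g f → _≈ₚ_ K D f (scaledShift r h ι g ++ (f ++ scaledShift (- r) h ι g))
    scaledShift-split g f m = ≈-sym (begin
      coeff K D (scaledShift r h ι g ++ (f ++ scaledShift (- r) h ι g)) m
        ≈⟨ coeff-++ (scaledShift r h ι g) _ m ⟩
      s + coeff K D (f ++ scaledShift (- r) h ι g) m   ≈⟨ +-congˡ (coeff-++ f _ m) ⟩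
      s + (x + coeff K D (scaledShift (- r) h ι g) m)  ≈⟨ +-congˡ (+-congˡ (coeff-scaledShift-neg g m)) ⟩
      s + (x + - s)                                    ≈⟨ +-congˡ (+-comm x (- s)) ⟩
      s + (- s + x)                                    ≈⟨ \\-leftDividesˡ s x ⟩
      x                                                ∎)
      where
      s x : Carrier
      s = coeff K D (scaledShift r h ι g) m
      x = coeff K D f m

    scaledShift-cancel : ∀ g {f f'} → _≈ₚ_ K D f (scaledShift r h ι g ++ f') →
                         _≈ₚ_ K D f' (scaledShift (- r) h ι g ++ f)
    scaledShift-cancel g {f} {f'} f≈ m = begin
      coeff K D f' m                                        ≈⟨ \\-leftDividesʳ s (coeff K D f' m) ⟨
      - s + (s + coeff K D f' m)                            ≈⟨ +-congˡ (coeff-++ (scaledShift r h ι g) f' m) ⟨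
      - s + coeff K D (scaledShift r h ι g ++ f') m         ≈⟨ +-congˡ (f≈ m) ⟨
      - s + coeff K D f m                                   ≈⟨ +-congʳ (coeff-scaledShift-neg g m) ⟨
      coeff K D (scaledShift (- r) h ι g) m + coeff K D f m  ≈⟨ coeff-++ (scaledShift (- r) h ι g) f m ⟨
      coeff K D (scaledShift (- r) h ι g ++ f) m            ∎
      where
      s : Carrier
      s = coeff K D (scaledShift r h ι g) m

  IsLM⇒maximal : ∀ g {mg} → IsLM K D g mg → ∀ m → ¬ coeff K D g m ≈ 0# → m ≤ₗ mg
  IsLM⇒maximal g (_ , maximal) m nz = Sum.map mk<ₗ mk≃ (maximal m nz)

  scaledShift-below-lm : ∀ r h ι g {mg m} → IsLM K D g mg → ¬ coeff K D (scaledShift r h ι g) m ≈ 0# →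
                         m ≤ₗ shift h ι mg
  scaledShift-below-lm r h ι g lm nz with scaledShift-support r h ι g nz
  ... | m₀ , e , nz₀ = ≤ₗ-respˡ-≃ (≃-sym e) (shift-mono-≤ₗ h ι (IsLM⇒maximal g lm m₀ nz₀))

  largest-monomial : ∀ (Q : Mon K D → Set) → (∀ {m m'} → m ≃ m' → Q m → Q m') → ∀ f →
                     ∃[ m ] (Q m × ¬ coeff K D f m ≈ 0#) →
                     ∃[ M ] ((Q M × ¬ coeff K D f M ≈ 0#) ×
                             (∀ m → Q m → ¬ coeff K D f m ≈ 0# → m ≤ₗ M))
  largest-monomial Q Q-resp f (m , qm , nz) =
    let M , PM , _ , maximal = maximum-satisfying ≤ₗ-total ≤ₗ-trans (λ _ → em)
                                 (Any.map (λ e → transport e (qm , nz)) (coeff≉0⇒∈ f m nz))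
    in M , PM , λ m' qm' nz' →
         let below-M , e = All.lookupAny maximal (coeff≉0⇒∈ f m' nz')
         in ≤ₗ-respˡ-≃ (≃-sym e) (below-M (transport e (qm' , nz')))
    where
    transport : ∀ {m m'} → m ≃ m' → Q m × ¬ coeff K D f m ≈ 0# → Q m' × ¬ coeff K D f m' ≈ 0#
    transport e (qm , nz) = Q-resp e qm , nz ∘ ≈-trans (coeff-cong f e)

  leading-monomial : ∀ f → ¬ IsZero K D f → ∃[ M ] IsLM K D f M
  leading-monomial f f≉0 =
    let M , (_ , nzM) , maximal = largest-monomial (λ _ → ⊤) _ f some-nonzero
    in M , nzM , λ m nz → Sum.map lex deg≡ (maximal m tt nz)
    where
    some-nonzero : ∃[ m ] (⊤ × ¬ coeff K D f m ≈ 0#)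
    some-nonzero = decidable-stable em λ none → f≉0 λ m → decidable-stable em λ nz → none (m , tt , nz)

module Reduction (em : ExcludedMiddle 0ℓ) (K : Field) (D : Domain) (G : Poly K D → Set) where
  open Field K renaming (refl to ≈-refl; sym to ≈-sym; trans to ≈-trans)
  open Monomials K D
  open Polynomials em K D
  open import Relation.Binary.Reasoning.Setoid setoid

  Reducible : Mon K D → Set
  Reducible m = ∃[ g ] (G g × ∃[ mg ] (IsLM K D g mg × _⊑_ K D mg m))

  Reducible-resp-≃ : ∀ {m m'} → m ≃ m' → Reducible m → Reducible m'
  Reducible-resp-≃ e (g , g∈G , mg , lm , ι , h , ιmg·h≈m) =
    g , g∈G , mg , lm , ι , h , λ a → trans (ιmg·h≈m a) (deg≡ e a)

  eliminate : ∀ f {m} → ¬ coeff K D f m ≈ 0# → Reducible m →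
              ∃[ f' ] (Step K D G f f' × coeff K D f' m ≈ 0# ×
                       (∀ m' → m <ₗ m' → coeff K D f' m' ≈ coeff K D f m'))
  eliminate f {m} f[m]≉0 (g , g∈G , mg , lm , ι , h , ιmg·h≈m) = f' , step , vanishes , unchanged
    where
    m≃ : m ≃ shift h ι mg
    m≃ = ≃-sym (≃-trans (++-comm-≃ h (renMon K D ι mg)) (mk≃ ιmg·h≈m))
    lc lc⁻¹ c r : Carrier
    lc = coeff K D g mg
    lc⁻¹ = proj₁ (inverse lc (proj₁ lm))
    c = coeff K D f (shift h ι mg)
    r = c * lc⁻¹
    f' : Poly K D
    f' = f ++ scaledShift (- r) h ι g

    r*lc≈c : r * lc ≈ c
    r*lc≈c = begin
      c * lc⁻¹ * lc    ≈⟨ *-assoc c lc⁻¹ lc ⟩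
      c * (lc⁻¹ * lc)  ≈⟨ *-congˡ (*-comm lc⁻¹ lc) ⟩
      c * (lc * lc⁻¹)  ≈⟨ *-congˡ (proj₂ (inverse lc (proj₁ lm))) ⟩
      c * 1#           ≈⟨ *-identityʳ c ⟩
      c                ∎

    step : Step K D G f f'
    step = r , h , ι , g , g∈G , mg , lm , f[m]≉0 ∘ ≈-trans (coeff-cong f m≃) , ≈-sym r*lc≈c ,
           scaledShift-split r h ι g f

    vanishes : coeff K D f' m ≈ 0#
    vanishes = begin
      coeff K D f' m                                         ≈⟨ coeff-++ f _ m ⟩
      coeff K D f m + coeff K D (scaledShift (- r) h ι g) m
        ≈⟨ +-cong (coeff-cong f m≃) (coeff-scaledShift-neg r h ι g m) ⟩
      c + - coeff K D (scaledShift r h ι g) m                ≈⟨ +-congˡ (-‿cong (coeff-scaledShift r h ι g m≃)) ⟩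
      c + - (r * lc)                                         ≈⟨ +-congˡ (-‿cong r*lc≈c) ⟩
      c + - c                                                ≈⟨ -‿inverseʳ c ⟩
      0#                                                     ∎

    unchanged : ∀ m' → m <ₗ m' → coeff K D f' m' ≈ coeff K D f m'
    unchanged m' m<m' = begin
      coeff K D f' m'                                          ≈⟨ coeff-++ f _ m' ⟩
      coeff K D f m' + coeff K D (scaledShift (- r) h ι g) m'  ≈⟨ +-congˡ (decidable-stable em above-lm) ⟩
      coeff K D f m' + 0#                                      ≈⟨ +-identityʳ _ ⟩
      coeff K D f m'                                           ∎
      where
      above-lm : ¬ ¬ coeff K D (scaledShift (- r) h ι g) m' ≈ 0#
      above-lm nz = <ₗ⇒≱ₗ (<ₗ-respˡ-≃ m≃ m<m') (scaledShift-below-lm (- r) h ι g lm nz)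

  ReducibleTerm : Poly K D → Mon K D → Set
  ReducibleTerm f m = ¬ coeff K D f m ≈ 0# × Reducible m

  Step⇒ReducibleTerm : ∀ {f f'} → Step K D G f f' → ∃[ m ] ReducibleTerm f m
  Step⇒ReducibleTerm (r , h , ι , g , g∈G , mg , lm , f[m]≉0 , _) =
    shift h ι mg , f[m]≉0 , g , g∈G , mg , lm , ι , h , deg≡ (++-comm-≃ (renMon K D ι mg) h)

  ReducibleBelow : Mon K D → Poly K D → Set
  ReducibleBelow M f = ∀ m → ReducibleTerm f m → m <ₗ M

  reduced-or-eliminate : ∀ f → Reduced K D G f ⊎
                         ∃[ M ] (ReducibleTerm f M × ∃[ f' ] (Step K D G f f' × ReducibleBelow M f'))
  reduced-or-eliminate f with em {∃[ m ] ReducibleTerm f m}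
  ... | no none = inj₁ λ (f' , step) → none (Step⇒ReducibleTerm {f} {f'} step)
  ... | yes (m , f[m]≉0 , red) with largest-monomial Reducible Reducible-resp-≃ f (m , red , f[m]≉0)
  ...   | M , (redM , f[M]≉0) , maximal with eliminate f f[M]≉0 redM
  ...     | f' , step , vanishes , unchanged = inj₂ (M , (f[M]≉0 , redM) , f' , step , below)
    where
    below : ReducibleBelow M f'
    below m' (f'[m']≉0 , red') with <ₗ-compare m' M
    ... | tri< m'<M _ _ = m'<M
    ... | tri≈ _ m'≃M _ = contradiction (≈-trans (coeff-cong f' m'≃M) vanishes) f'[m']≉0
    ... | tri> _ _ M<m' =
      contradiction (maximal m' red' (f'[m']≉0 ∘ ≈-trans (unchanged m' M<m'))) (<ₗ⇒≱ₗ M<m')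

  NormalForm : Poly K D → Set
  NormalForm f = ∃[ f' ] (_→*_ K D G f f' × Reduced K D G f')

  normalForm-below : ∀ {M} → Acc _<ₗ_ M → ∀ f → ReducibleBelow M f → NormalForm f
  normalForm-below (acc rs) f below with reduced-or-eliminate f
  ... | inj₁ reduced = f , ε , reduced
  ... | inj₂ (M , termM , f' , step , below') =
    let f'' , f'→*f'' , reduced = normalForm-below (rs (below M termM)) f' below'
    in f'' , step ◅ f'→*f'' , reduced

  normalForm : ∀ f → NormalForm f
  normalForm f with reduced-or-eliminate f
  ... | inj₁ reduced = f , ε , reduced
  ... | inj₂ (M , _ , f' , step , below) =
    let f'' , f'→*f'' , reduced = normalForm-below (<ₗ-wellFounded M) f' below
    in f'' , step ◅ f'→*f'' , reduced

  IsZero⇒InIdeal : ∀ f → IsZero K D f → InIdeal K D G f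
  IsZero⇒InIdeal f f≈0 = [] , [] , f≈0

  Step-reflects-InIdeal : ∀ {f f'} → Step K D G f f' → InIdeal K D G f' → InIdeal K D G f
  Step-reflects-InIdeal (r , h , ι , g , g∈G , _ , _ , _ , _ , f≈) (xs , xs⊆G , f'≈) =
    (term K D r h , ι , g) ∷ xs , g∈G ∷ xs⊆G ,
    λ m → ≈-trans (f≈ m) (++-congˡ-≈ₚ (scaledShift r h ι g) f'≈ m)

  Step-preserves-InIdeal : ∀ {f f'} → Step K D G f f' → InIdeal K D G f → InIdeal K D G f'
  Step-preserves-InIdeal {f} {f'} (r , h , ι , g , g∈G , _ , _ , _ , _ , f≈) (xs , xs⊆G , f≈comb) =
    (term K D (- r) h , ι , g) ∷ xs , g∈G ∷ xs⊆G ,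
    λ m → ≈-trans (scaledShift-cancel r h ι g {f} {f'} f≈ m)
                  (++-congˡ-≈ₚ (scaledShift (- r) h ι g) f≈comb m)

  →*-reflects-InIdeal : ∀ {f f'} → _→*_ K D G f f' → InIdeal K D G f' → InIdeal K D G f
  →*-reflects-InIdeal ε = id
  →*-reflects-InIdeal (_◅_ {i = f} {j = f₁} step steps) =
    Step-reflects-InIdeal {f} {f₁} step ∘ →*-reflects-InIdeal steps

  →*-preserves-InIdeal : ∀ {f f'} → _→*_ K D G f f' → InIdeal K D G f → InIdeal K D G f'
  →*-preserves-InIdeal ε = id
  →*-preserves-InIdeal (_◅_ {i = f} {j = f₁} step steps) =
    →*-preserves-InIdeal steps ∘ Step-preserves-InIdeal {f} {f₁} step

  InIdeal∧Reduced⇒IsZero : IsGroebner K D G → ∀ f → InIdeal K D G f → Reduced K D G f → IsZero K D f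
  InIdeal∧Reduced⇒IsZero groebner f f∈I reduced = decidable-stable em λ f≉0 →
    let M , lmM = leading-monomial f f≉0
        f' , step , _ = eliminate f (proj₁ lmM) (groebner f f∈I f≉0 M lmM)
    in reduced (f' , step)

  InIdeal⇒reducts-zero : IsGroebner K D G → ∀ {f} → InIdeal K D G f →
                         ∀ f' → _→*_ K D G f f' → Reduced K D G f' → IsZero K D f'
  InIdeal⇒reducts-zero groebner f∈I f' f→*f' = InIdeal∧Reduced⇒IsZero groebner f' (→*-preserves-InIdeal f→*f' f∈I)

lemma6p3 : ExcludedMiddle 0ℓ → (K : Field) (D : Domain) (G : Poly K D → Set) →
    (∀ g → G g → ¬ IsZero K D g) → IsGroebner K D G →
    ∀ (f : Poly K D) →
      (InIdeal K D G f ⇔ (∃[ z ] (_→*_ K D G f z × IsZero K D z)))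
      × (InIdeal K D G f ⇔ (∀ f' → _→*_ K D G f f' → Reduced K D G f' → IsZero K D f'))
-- The generators need not be nonzero: division steps only use generators
-- having a leading monomial.
lemma6p3 em K D G _ groebner f with Reduction.normalForm em K D G f
... | f' , f→*f' , reduced =
  mk⇔ (λ f∈I → f' , f→*f' , InIdeal⇒reducts-zero groebner f∈I f' f→*f' reduced)
      (λ (z , f→*z , z≈0) → →*-reflects-InIdeal f→*z (IsZero⇒InIdeal z z≈0)) ,
  mk⇔ (InIdeal⇒reducts-zero groebner)
      (λ reducts-zero → →*-reflects-InIdeal f→*f' (IsZero⇒InIdeal f' (reducts-zero f' f→*f' reduced)))
  where open Reduction em K D G
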